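{- Let $\gamma\in\Omega$, let $n\ge1$, and assume that the vertex $w$ at level $n$ is in a stable cycle of $\gamma$ of length $k\ge1$. Then for each $i=0,\dots,k-1$, the section of $\gamma^k$ at the vertex $(w)\gamma^i$ is an odometer.
   Context: $T$ is the regular rooted binary tree whose vertices are finite words over $\{0,1\}$ (level $n$ = words of length $n$); $\Omega=\mathrm{Aut}(T)$, acting on the right. For $\gamma\in\Omega$ and a word $u$, the section $\gamma_u\in\Omega$ is the unique automorphism with $(uv)\gamma=(u)\gamma\,(v)\gamma_u$ for every word $v$. An odometer is an element of $\Omega$ acting as a single $2^m$-cycle on level $m$ for every $m\ge1$. A vertex $v$ at level $n$ is in a stable cycle of length $k\ge1$ of $\gamma$ if the orbit $\{(v)\gamma^i:i\ge0\}$ has exactly $k$ elements and, for every $m>n$, all vertices at level $m$ lying above (i.e. having as prefix) an element of this orbit lie in a single cycle of $\gamma$ of length $2^{m-n}k$. -}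

module Defs where

open import Data.Bool using (Bool)
open import Data.Nat using (ℕ; zero; suc; _+_; _*_; _^_; _<_; _≤_)
open import Data.Vec using (Vec; _++_; take; drop)
open import Data.Product using (_×_; ∃)
open import Relation.Binary.PropositionalEquality using (_≡_; _≢_)
open import Function.Definitions using (Bijective)

Vertex : ℕ → Set
Vertex n = Vec Bool n

LevelMap : Set
LevelMap = ∀ {n} → Vertex n → Vertex n

-- Ω = Aut(T): bijective on each level and preserving the prefix (ancestor)
-- relation, i.e. the image of uv has the image of u as prefix.
record Aut : Set where
  field
    act    : LevelMap
    prefix : ∀ {n m} (u : Vertex n) (v : Vertex m) → take n (act (u ++ v)) ≡ act u
    bij    : ∀ {n} → Bijective _≡_ _≡_ (act {n})
open Aut public

iter : LevelMap → ℕ → LevelMap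
iter g zero    v = v
iter g (suc i) v = g (iter g i v)

pow : Aut → ℕ → LevelMap
pow γ = iter (act γ)

-- Section of a tree automorphism (given by its action g) at vertex u:
-- the unique map g_u with (uv)g = (u)g (v)g_u, i.e. (v)g_u = drop |u| ((uv)g).
section : LevelMap → ∀ {n} → Vertex n → LevelMap
section g {n} u v = drop n (g (u ++ v))

CycleLength : LevelMap → ∀ {n} → Vertex n → ℕ → Set
CycleLength g v k =
  (0 < k) × (iter g k v ≡ v) × (∀ j → 0 < j → j < k → iter g j v ≢ v)

SameCycle : LevelMap → ∀ {n} → Vertex n → Vertex n → Set
SameCycle g x y = ∃ λ j → iter g j x ≡ y

IsOdometer : LevelMap → Set
IsOdometer g = ∀ m → 1 ≤ m →
  (∀ (v : Vertex m) → CycleLength g v (2 ^ m)) ×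
  (∀ (v w : Vertex m) → SameCycle g v w)

-- w (at level n) is in a stable cycle of γ of length k: the orbit of w has
-- exactly k elements, and for every m = n + d > n, all level-m vertices above
-- an orbit element lie in a single cycle of γ of length 2^d * k.
StableCycle : Aut → ∀ {n} → Vertex n → ℕ → Set
StableCycle γ {n} w k =
  CycleLength (act γ) w k ×
  (∀ d → 1 ≤ d →
     (∀ i (u : Vertex d) → CycleLength (act γ) (pow γ i w ++ u) (2 ^ d * k)) ×
     (∀ i i′ (u u′ : Vertex d) → SameCycle (act γ) (pow γ i w ++ u) (pow γ i′ w ++ u′)))

{-# OPTIONS --safe #-}
module Submission where

-- Let x = (w)γ^i. Since γ^k fixes x and preserves prefixes, (xv)γ^(jk) = x (v)h^j
-- for the section h of γ^k at x, so the γ^k-orbit of xv is the h-orbit of v behind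
-- the fixed prefix x. A γ-cycle of length 2^m k through xv is a γ^k-cycle of
-- length 2^m, and any power γ^j joining xv to xv′ fixes x, so k ∣ j and the join
-- is already a power of γ^k.

open import Defs
open import Data.Nat using (ℕ; zero; suc; _+_; _*_; _^_; _<_; _≤_; z<s; >-nonZero)
open import Data.Nat.Properties using (+-comm; *-monoˡ-<; m*n≢0⇒n≢0; n≤0⇒n≡0; ≮⇒≥)
open import Data.Nat.DivMod using (_%_; _/_; m≡m%n+[m/n]*n; m%n<n)
open import Data.Nat.Divisibility using (_∣_; divides-refl; m%n≡0⇒n∣m)
open import Data.Vec using (Vec; _++_; take; drop)
open import Data.Vec.Properties using (take++drop≡id; ++-injectiveˡ; ++-injectiveʳ)
open import Data.Product using (_,_; proj₁; proj₂)
open import Function.Definitions using (Injective)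
open import Relation.Binary.PropositionalEquality
open ≡-Reasoning

take-++ : ∀ {a} {A : Set a} {n m} (xs : Vec A n) (ys : Vec A m) → take n (xs ++ ys) ≡ xs
take-++ {n = n} xs ys = ++-injectiveˡ (take n (xs ++ ys)) xs (take++drop≡id n (xs ++ ys))

iter-+ : ∀ (g : LevelMap) a b {n} (v : Vertex n) → iter g (a + b) v ≡ iter g a (iter g b v)
iter-+ g zero    b v = refl
iter-+ g (suc a) b v = cong g (iter-+ g a b v)

iter-* : ∀ (g : LevelMap) j k {n} (v : Vertex n) → iter (iter g k) j v ≡ iter g (j * k) v
iter-* g zero    k v = refl
iter-* g (suc j) k v = begin
  iter g k (iter (iter g k) j v) ≡⟨ cong (iter g k) (iter-* g j k v) ⟩
  iter g k (iter g (j * k) v)    ≡⟨ iter-+ g k (j * k) v ⟨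
  iter g (k + j * k) v           ∎

iter-comm : ∀ (g : LevelMap) a b {n} (v : Vertex n) → iter g a (iter g b v) ≡ iter g b (iter g a v)
iter-comm g a b v = begin
  iter g a (iter g b v) ≡⟨ iter-+ g a b v ⟨
  iter g (a + b) v      ≡⟨ cong (λ t → iter g t v) (+-comm a b) ⟩
  iter g (b + a) v      ≡⟨ iter-+ g b a v ⟩
  iter g b (iter g a v) ∎

iter-fixed : ∀ (g : LevelMap) j {n} {v : Vertex n} → g v ≡ v → iter g j v ≡ v
iter-fixed g zero    fixed = refl
iter-fixed g (suc j) fixed = trans (cong g (iter-fixed g j fixed)) fixed

iter-injective : ∀ {g : LevelMap} → (∀ {n} → Injective _≡_ _≡_ (g {n})) →
                 ∀ j {n} → Injective _≡_ _≡_ (iter g j {n})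
iter-injective inj zero    eq = eq
iter-injective inj (suc j) eq = iter-injective inj j (inj eq)

module _ {g : LevelMap} where

  cycleLength-orbit : (∀ {n} → Injective _≡_ _≡_ (g {n})) →
                      ∀ i {n} {w : Vertex n} {k} → CycleLength g w k → CycleLength g (iter g i w) k
  cycleLength-orbit inj i {w = w} {k} (k>0 , returns , minimal) =
    k>0 , trans (iter-comm g k i w) (cong (iter g i) returns) , minimal′
    where
    minimal′ : ∀ j → 0 < j → j < k → iter g j (iter g i w) ≢ iter g i w
    minimal′ j j>0 j<k eq =
      minimal j j>0 j<k (iter-injective inj i (trans (iter-comm g i j w) eq))

  cycleLength-iter : ∀ {n} {z : Vertex n} {L k} → CycleLength g z (L * k) → CycleLength (iter g k) z L
  cycleLength-iter {L = zero} (() , _)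
  cycleLength-iter {z = z} {L@(suc _)} {k} (Lk>0 , returns , minimal) =
    z<s , trans (iter-* g L k z) returns , minimal′
    where
    instance
      k≢0 = m*n≢0⇒n≢0 L {{>-nonZero Lk>0}}
    minimal′ : ∀ j → 0 < j → j < L → iter (iter g k) j z ≢ z
    minimal′ j j>0 j<L eq =
      minimal (j * k) (*-monoˡ-< k j>0) (*-monoˡ-< k j<L) (trans (sym (iter-* g j k z)) eq)

  period-∣ : ∀ {n} {x : Vertex n} {k} → CycleLength g x k → ∀ j → iter g j x ≡ x → k ∣ j
  period-∣ {x = x} {k@(suc _)} (_ , returns , minimal) j eq = m%n≡0⇒n∣m j k r≡0
    where
    r = j % k
    q = j / k
    r-returns : iter g r x ≡ x
    r-returns = begin
      iter g r x                     ≡⟨ cong (iter g r) (iter-fixed (iter g k) q returns) ⟨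
      iter g r (iter (iter g k) q x) ≡⟨ cong (iter g r) (iter-* g q k x) ⟩
      iter g r (iter g (q * k) x)    ≡⟨ iter-+ g r (q * k) x ⟨
      iter g (r + q * k) x           ≡⟨ cong (λ t → iter g t x) (m≡m%n+[m/n]*n j k) ⟨
      iter g j x                     ≡⟨ eq ⟩
      x                              ∎
    r≡0 : r ≡ 0
    r≡0 = n≤0⇒n≡0 (≮⇒≥ (λ r>0 → minimal r r>0 (m%n<n j k) r-returns))

  sameCycle-iter : ∀ {n} {a b : Vertex n} {j k} → k ∣ j → iter g j a ≡ b → SameCycle (iter g k) a b
  sameCycle-iter {a = a} {k = k} (divides-refl q) eq = q , trans (iter-* g q k a) eq

PrefixPreserving : LevelMap → Set
PrefixPreserving g = ∀ {n m} (u : Vertex n) (v : Vertex m) → take n (g (u ++ v)) ≡ g u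

++-section : ∀ {g : LevelMap} → PrefixPreserving g →
             ∀ {n m} (u : Vertex n) (v : Vertex m) → g (u ++ v) ≡ g u ++ section g u v
++-section {g} preserves {n} u v = begin
  g (u ++ v)                                 ≡⟨ take++drop≡id n (g (u ++ v)) ⟨
  take n (g (u ++ v)) ++ drop n (g (u ++ v)) ≡⟨ cong (_++ section g u v) (preserves u v) ⟩
  g u ++ section g u v                       ∎

module _ {g : LevelMap} (preserves : PrefixPreserving g) where

  iter-prefixPreserving : ∀ j → PrefixPreserving (iter g j)
  iter-prefixPreserving zero    u v = take-++ u v
  iter-prefixPreserving (suc j) {n} u v = begin
    take n (g (iter g j (u ++ v)))
      ≡⟨ cong (λ y → take n (g y)) (++-section (iter-prefixPreserving j) u v) ⟩
    take n (g (iter g j u ++ section (iter g j) u v))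
      ≡⟨ preserves (iter g j u) (section (iter g j) u v) ⟩
    g (iter g j u)
      ∎

  module _ {n} {x : Vertex n} (fixed : g x ≡ x) where

    iter-++-section : ∀ j {m} (y : Vertex m) → iter g j (x ++ y) ≡ x ++ iter (section g x) j y
    iter-++-section zero    y = refl
    iter-++-section (suc j) y = begin
      g (iter g j (x ++ y))                        ≡⟨ cong g (iter-++-section j y) ⟩
      g (x ++ iter (section g x) j y)              ≡⟨ ++-section preserves x (iter (section g x) j y) ⟩
      g x ++ iter (section g x) (suc j) y          ≡⟨ cong (_++ iter (section g x) (suc j) y) fixed ⟩
      x ++ iter (section g x) (suc j) y            ∎

    cycleLength-section : ∀ {m} {y : Vertex m} {L} → CycleLength g (x ++ y) L → CycleLength (section g x) y L
    cycleLength-section {y = y} {L} (L>0 , returns , minimal) =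
      L>0 ,
      ++-injectiveʳ x x (trans (sym (iter-++-section L y)) returns) ,
      λ j j>0 j<L eq → minimal j j>0 j<L (trans (iter-++-section j y) (cong (x ++_) eq))

    sameCycle-section : ∀ {m} {y y′ : Vertex m} → SameCycle g (x ++ y) (x ++ y′) → SameCycle (section g x) y y′
    sameCycle-section {y = y} (j , eq) = j , ++-injectiveʳ x x (trans (sym (iter-++-section j y)) eq)

-- The hypotheses 1 ≤ n, 1 ≤ k and i < k are unused: k > 0 is part of CycleLength,
-- and the argument works for every point (w)γ^i of the orbit.
proposition5p6 : (γ : Aut) (n : ℕ) → 1 ≤ n → (w : Vertex n) (k : ℕ) → 1 ≤ k →
    StableCycle γ w k →
    ∀ i → i < k → IsOdometer (section (pow γ k) (pow γ i w))
proposition5p6 γ n _ w k _ (w-cycle , stable) i _ m m≥1 = cycle , sameCycle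
  where
  x = pow γ i w
  x-cycle : CycleLength (act γ) x k
  x-cycle = cycleLength-orbit (proj₁ (bij γ)) i w-cycle
  x-fixed : pow γ k x ≡ x
  x-fixed = proj₁ (proj₂ x-cycle)
  preserves : ∀ j → PrefixPreserving (pow γ j)
  preserves = iter-prefixPreserving (prefix γ)
  cycle : ∀ (v : Vertex m) → CycleLength (section (pow γ k) x) v (2 ^ m)
  cycle v = cycleLength-section (preserves k) x-fixed
              (cycleLength-iter (proj₁ (stable m m≥1) i v))
  sameCycle : ∀ (v v′ : Vertex m) → SameCycle (section (pow γ k) x) v v′
  sameCycle v v′ with proj₂ (stable m m≥1) i i v v′
  ... | j , eq = sameCycle-section (preserves k) x-fixed
                   (sameCycle-iter (period-∣ x-cycle j x-returns) eq)
    where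
    x-returns : pow γ j x ≡ x
    x-returns = trans (sym (preserves j x v)) (trans (cong (take n) eq) (take-++ x v′))
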